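{- For every $k\in\omega$, $\nu(\mathbb{C}_k)\ge k+1$.
   Context: Fix a positive integer $n$ and real $0<r<n$. For each $k\in\omega$ fix $M_k\in\omega$ so large that $2^k(\sqrt{n}/M_k)^r<2^{ -k}$. Let $C_k$ be the set of all cubes $[\frac{j_0}{M_k},\frac{j_0+1}{M_k}]\times\dots\times[\frac{j_{n-1}}{M_k},\frac{j_{n-1}+1}{M_k}]$ with $j_i\in\{0,\dots,M_k-1\}$, and let $\mathbb{C}_k$ be the set of all sets that can be written as the union of $2^k$ elements of $C_k$. The norm $\nu$ on subsets $X\subset\mathbb{C}_k$ is defined by: $\nu(X)\ge 0$ always; $\nu(X)\ge1$ iff $\bigcup X=[0,1]^n$; and $\nu(X)\ge j+1$ (for $j\ge1$) iff for every partition $X=X_0\cup X_1$ there is $i\in\{0,1\}$ with $\nu(X_i)\ge j$. $\nu(X)$ is the largest $j$ with $\nu(X)\ge j$. -}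

module Defs where

open import Data.Nat using (ℕ; zero; suc; _^_)
open import Data.Bool using (Bool; true; false)
open import Data.Fin using (Fin)
open import Data.Fin.Subset using (Subset; _∈_; ∣_∣)
open import Data.Product using (Σ; _×_)
open import Data.Sum using (_⊎_)
open import Data.Unit using (⊤)
open import Relation.Binary.PropositionalEquality using (_≡_)

-- Grid cubes of C_k (side 1/M, inside [0,1]^n): there are M^n of them,
-- indexed by Fin (M ^ n) (a fixed bijection with the coordinate tuples
-- (j_0,…,j_{n-1}) ∈ {0,…,M-1}^n; the statement is invariant under relabelling).
Cell : ℕ → ℕ → Set
Cell n M = Fin (M ^ n)

-- A union of grid cubes is determined by (and determines) the set of cubes
-- it is the union of; we represent it by that set of cubes.
Block : ℕ → ℕ → Set
Block n M = Subset (M ^ n)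

Family : ℕ → ℕ → Set₁
Family n M = Block n M → Set

ℂ : (n M k : ℕ) → Family n M
ℂ n M k b = ∣ b ∣ ≡ 2 ^ k

-- ⋃ X = [0,1]^n  iff every grid cube is contained in some member of X.
Covers : ∀ {n M} → Family n M → Set
Covers {n} {M} X = (x : Cell n M) → Σ (Block n M) (λ b → X b × x ∈ b)

-- NormGe j X  means  ν(X) ≥ j.  Partitions X = X₀ ∪ X₁ are given by a
-- 2-colouring c of blocks: X_i = X ∩ c⁻¹(i).
NormGe : ∀ {n M} → ℕ → Family n M → Set
NormGe zero X = ⊤
NormGe {n} {M} (suc zero) X = Covers {n} {M} X
NormGe {n} {M} (suc (suc j)) X =
  (c : Block n M → Bool) →
  NormGe {n} {M} (suc j) (λ b → X b × c b ≡ true) ⊎ NormGe {n} {M} (suc j) (λ b → X b × c b ≡ false)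

module Submission where

open import Defs
open import Data.Nat as ℕ using (ℕ; zero; suc; _+_; _*_; _^_; _<_; _≤_; z≤n; s≤s)
open import Data.Nat.Properties
open import Data.Bool using (Bool; true; false)
import Data.Bool.Properties as Bool
open import Data.Fin.Subset using (Subset; ∣_∣; _⊆_; _∪_; ⊤; ⁅_⁆; inside; outside)
open import Data.Fin.Subset.Properties
  using (anySubset?; _⊆?_; ⊆⊤; ∣⊤∣≡n; ∣p∣≤∣x∷p∣; out⊆; s⊆s; p⊆p∪q; q⊆p∪q; x∈⁅x⁆; ∣⁅x⁆∣≡1)
open import Data.Empty using (⊥; ⊥-elim)
open import Data.Product using (_×_; _,_; ∃)
open import Data.Sum using (_⊎_; inj₁; inj₂)
import Data.Sum as Sum
open import Data.Vec using (_∷_; [])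
open import Function using (_∘_)
open import Relation.Nullary using (yes; no; ¬_)
open import Relation.Nullary.Decidable using (_×-dec_; ¬?; decidable-stable)
open import Relation.Unary using (Decidable)
open import Relation.Binary.PropositionalEquality using (_≡_; refl; sym; cong)

-- Call a family X m-absorbing when every set of at most m cells lies inside a
-- member of X.  A 1-absorbing family covers, and if X is 2m-absorbing then
-- for every 2-colouring one colour class is m-absorbing: counterexamples S₀, S₁
-- for the two classes have a union of at most 2m cells, which lies inside a
-- member of X, and the colour of that member refutes one of them.  By
-- induction a 2^k-absorbing family has norm at least k + 1.  Finally ℂ n M k
-- is 2^k-absorbing as soon as 2^k ≤ M^n, because any set of at most 2^k cells
-- extends to one of exactly 2^k cells, and 2^k ≤ M^n follows from the
-- hypothesis by comparing squares.

∣p∪q∣≤∣p∣+∣q∣ : ∀ {N} (p q : Subset N) → ∣ p ∪ q ∣ ≤ ∣ p ∣ + ∣ q ∣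
∣p∪q∣≤∣p∣+∣q∣ []            []            = z≤n
∣p∪q∣≤∣p∣+∣q∣ (inside ∷ p)  (s ∷ q)       =
  s≤s (≤-trans (∣p∪q∣≤∣p∣+∣q∣ p q) (+-monoʳ-≤ ∣ p ∣ (∣p∣≤∣x∷p∣ s q)))
∣p∪q∣≤∣p∣+∣q∣ (outside ∷ p) (inside ∷ q)  =
  ≤-trans (s≤s (∣p∪q∣≤∣p∣+∣q∣ p q)) (≤-reflexive (sym (+-suc ∣ p ∣ ∣ q ∣)))
∣p∪q∣≤∣p∣+∣q∣ (outside ∷ p) (outside ∷ q) = ∣p∪q∣≤∣p∣+∣q∣ p q

⊆-extend : ∀ {N t} (S : Subset N) → ∣ S ∣ ≤ t → t ≤ N → ∃ λ b → S ⊆ b × ∣ b ∣ ≡ t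
⊆-extend {N} S ∣S∣≤t t≤N with m≤n⇒m<n∨m≡n t≤N
... | inj₂ refl = ⊤ , ⊆⊤ , ∣⊤∣≡n N
⊆-extend (outside ∷ S) ∣S∣≤t _ | inj₁ (s≤s t≤N) with ⊆-extend S ∣S∣≤t t≤N
... | b , S⊆b , ∣b∣≡t = outside ∷ b , out⊆ S⊆b , ∣b∣≡t
⊆-extend (inside ∷ S) (s≤s ∣S∣≤t) (s≤s _) | inj₁ (s≤s t<N) with ⊆-extend S ∣S∣≤t (<⇒≤ t<N)
... | b , S⊆b , ∣b∣≡t = inside ∷ b , s⊆s S⊆b , cong suc ∣b∣≡t

module _ {N : ℕ} where

  LiesInside : (Subset N → Set) → Subset N → Set
  LiesInside X S = ∃ λ b → X b × S ⊆ b

  Absorbing : ℕ → (Subset N → Set) → Set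
  Absorbing m X = ∀ S → ∣ S ∣ ≤ m → LiesInside X S

  ColourClass : (Subset N → Set) → (Subset N → Bool) → Bool → Subset N → Set
  ColourClass X c v b = X b × c b ≡ v

  liesInside? : ∀ {X} → Decidable X → Decidable (LiesInside X)
  liesInside? X? S = anySubset? (λ b → X? b ×-dec (S ⊆? b))

  colourClass? : ∀ {X} → Decidable X → ∀ c v → Decidable (ColourClass X c v)
  colourClass? X? c v b = X? b ×-dec (c b Bool.≟ v)

  counterexample⊎absorbing : ∀ {X} → Decidable X → ∀ m →
    (∃ λ S → ∣ S ∣ ≤ m × ¬ LiesInside X S) ⊎ Absorbing m X
  counterexample⊎absorbing X? m
    with anySubset? (λ S → (∣ S ∣ ℕ.≤? m) ×-dec ¬? (liesInside? X? S))
  ... | yes counterexample = inj₁ counterexample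
  ... | no ¬counterexample = inj₂ λ S ∣S∣≤m →
    decidable-stable (liesInside? X? S) (λ ¬inside → ¬counterexample (S , ∣S∣≤m , ¬inside))

  absorbing-colourClass : ∀ {X} → Decidable X → ∀ m → Absorbing (2 * m) X → ∀ c →
    Absorbing m (ColourClass X c true) ⊎ Absorbing m (ColourClass X c false)
  absorbing-colourClass X? m absorbing c
    with counterexample⊎absorbing (colourClass? X? c true) m
       | counterexample⊎absorbing (colourClass? X? c false) m
  ... | inj₂ absorbing₀ | _               = inj₁ absorbing₀
  ... | inj₁ _          | inj₂ absorbing₁ = inj₂ absorbing₁
  ... | inj₁ (S₀ , ∣S₀∣≤m , ¬inside₀) | inj₁ (S₁ , ∣S₁∣≤m , ¬inside₁) = ⊥-elim refuted
    where
    ∣S₀∪S₁∣≤2m : ∣ S₀ ∪ S₁ ∣ ≤ 2 * m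
    ∣S₀∪S₁∣≤2m = ≤-trans (∣p∪q∣≤∣p∣+∣q∣ S₀ S₁) (+-mono-≤ ∣S₀∣≤m (≤-trans ∣S₁∣≤m (m≤m+n m 0)))

    refuted : ⊥
    refuted with absorbing (S₀ ∪ S₁) ∣S₀∪S₁∣≤2m
    ... | b , Xb , S₀∪S₁⊆b with c b in cb
    ... | true  = ¬inside₀ (b , (Xb , cb) , S₀∪S₁⊆b ∘ p⊆p∪q S₁)
    ... | false = ¬inside₁ (b , (Xb , cb) , S₀∪S₁⊆b ∘ q⊆p∪q S₀ S₁)

absorbing⇒NormGe : ∀ {n M} j (X : Family n M) → Decidable X → Absorbing (2 ^ j) X →
  NormGe {n} {M} (suc j) X
absorbing⇒NormGe zero X X? absorbing x with absorbing ⁅ x ⁆ (≤-reflexive (∣⁅x⁆∣≡1 x))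
... | b , Xb , ⁅x⁆⊆b = b , Xb , ⁅x⁆⊆b (x∈⁅x⁆ x)
absorbing⇒NormGe (suc j) X X? absorbing c =
  Sum.map (absorbing⇒NormGe j _ (colourClass? X? c true))
          (absorbing⇒NormGe j _ (colourClass? X? c false))
          (absorbing-colourClass X? (2 ^ j) absorbing c)

ℂ-absorbing : ∀ n M k → 2 ^ k ≤ M ^ n → Absorbing (2 ^ k) (ℂ n M k)
ℂ-absorbing n M k 2^k≤M^n S ∣S∣≤2^k with ⊆-extend S ∣S∣≤2^k 2^k≤M^n
... | b , S⊆b , ∣b∣≡2^k = b , ∣b∣≡2^k , S⊆b

2^k≤M^n : ∀ n M k → 1 ≤ n → 16 ^ k * n ^ n < M ^ (2 * n) → 2 ^ k ≤ M ^ n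
2^k≤M^n n M k (s≤s z≤n) hyp = ≮⇒≥ λ M^n<2^k → <-asym hyp (begin-strict
  M ^ (2 * n)       ≡⟨ cong (M ^_) (*-comm 2 n) ⟩
  M ^ (n * 2)       ≡⟨ ^-*-assoc M n 2 ⟨
  (M ^ n) ^ 2       <⟨ ^-monoˡ-< 2 M^n<2^k ⟩
  (2 ^ k) ^ 2       ≡⟨ ^-*-assoc 2 k 2 ⟩
  2 ^ (k * 2)       ≡⟨ cong (2 ^_) (*-comm k 2) ⟩
  2 ^ (2 * k)       ≡⟨ ^-*-assoc 2 2 k ⟨
  4 ^ k             ≤⟨ ^-monoˡ-≤ k (s≤s (s≤s (s≤s (s≤s z≤n)))) ⟩
  16 ^ k            ≤⟨ m≤m*n (16 ^ k) (n ^ n) {{m^n≢0 n n}} ⟩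
  16 ^ k * n ^ n    ∎)
  where open ≤-Reasoning

lemma4p6 : (n : ℕ) → 1 ≤ n → (M k : ℕ) → 16 ^ k * n ^ n < M ^ (2 * n) →
    NormGe {n} {M} (suc k) (ℂ n M k)
lemma4p6 n 1≤n M k hyp =
  absorbing⇒NormGe k (ℂ n M k) (λ b → ∣ b ∣ ℕ.≟ 2 ^ k)
    (ℂ-absorbing n M k (2^k≤M^n n M k 1≤n hyp))
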